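{- Let $\mathcal C$ be a class of algebras closed under homomorphic images, and let $F,G\subseteq T_x$. If the pair $F,G$ determines principal subcongruences in $\mathcal C$, then $G\circ F$ determines syntactic congruences in $\mathcal C$.
   Context: Fix a denumerable set of variables $X=\{x,p_0,p_1,\dots\}$ with $x$ distinguished, and a set $T_x$ of terms over $X$ such that: $x\in T_x$; for each basic operation $\omega$ of positive arity $n$ and $i<n$, $\omega(p_0,\dots,p_{i-1},x,p_{i+1},\dots,p_{n-1})\in T_x$; and if $s(x,\bar p),t(x,\bar q)\in T_x$ then $s(t(x,\bar q),\bar p)\in T_x$. For $F,G\subseteq T_x$, $F\circ G=\{s(t(x,\bar q),\bar p): s(x,\bar p)\in F,\ t(x,\bar q)\in G\}$. A congruence formula is a first-order formula $\pi(u,v,x,y)$ of the form $\exists\bar p\,\bigl(u\approx t_0(z_0',\bar p)\wedge\bigwedge_{i=0}^{n-1}t_i(z_i,\bar p)\approx t_{i+1}(z_{i+1}',\bar p)\wedge t_n(z_n,\bar p)\approx v\bigr)$ with $t_0,\dots,t_n\in T_x$ and $\{z_i,z_i'\}=\{x,y\}$ for all $i$; write $\operatorname{term}(\pi)=\{t_0,\dots,t_n\}$. For $F\subseteq T_x$, an algebra $\mathbf A$ and $a,b\in A$, let $\theta^F(a,b)$ be the set of pairs $(c,d)\in A^2$ such that $\mathbf A\models\pi(c,d,a,b)$ for some congruence formula $\pi$ with $\operatorname{term}(\pi)\subseteq F$. Let $\theta(a,b)$ denote the principal congruence of $\mathbf A$ generated by $(a,b)$ (it equals $\theta^{T_x}(a,b)$).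 The pair $F,G$ determines principal subcongruences in $\mathcal C$ if for every $\mathbf A\in\mathcal C$ and every pair of distinct $a,b\in A$ there are distinct $c,d\in A$ with $(c,d)\in\theta^F(a,b)$ and $\theta(c,d)=\theta^G(c,d)$. For $F\subseteq T_x$ and an algebra $\mathbf A$, $F^{\mathbf A}$ is the set of maps $a\mapsto t(a,\bar e)$ with $t(x,\bar p)\in F$, $\bar e$ from $A$; for an equivalence relation $\theta$ on $A$, $\theta_F=\{(a,b):(f(a),f(b))\in\theta\ \forall f\in F^{\mathbf A}\}$ and $\operatorname{syn}(\theta)=\theta_{T_x}$. A set $H\subseteq T_x$ determines syntactic congruences in $\mathcal C$ if $\operatorname{syn}(\theta)=\theta_H$ for every equivalence relation $\theta$ on the carrier of every algebra of $\mathcal C$. -}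

module Defs where

open import Level using (Level; suc; _⊔_) renaming (zero to lzero)
open import Data.Nat using (ℕ; _*_) renaming (suc to sucℕ)
open import Data.Fin using (Fin; toℕ; _≟_)
open import Data.Bool using (Bool; true; false)
open import Data.List using (List; []; _∷_)
open import Data.List.Relation.Unary.All using (All)
open import Data.Product using (Σ; _×_; _,_)
open import Relation.Binary using (Rel; IsEquivalence)
open import Relation.Nullary using (¬_; yes; no)
open import Relation.Binary.PropositionalEquality using (_≡_)

record Signature : Set₁ where
  field
    Op    : Set
    arity : Op → ℕ

open Signature public

data Var : Set where
  vx : Var
  vp : ℕ → Var

module _ (S : Signature) where

  data Term : Set where
    var : Var → Term
    op  : (ω : Op S) → (Fin (arity S ω) → Term) → Term

module _ {S : Signature} where

  subst : (Var → Term S) → Term S → Term S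
  subst σ (var v)   = σ v
  subst σ (op ω ts) = op ω (λ i → subst σ (ts i))

  -- parameters of s are renamed to even indices, those of t to odd ones,
  -- so that the two parameter tuples p̄ and q̄ are disjoint.
  oddP : Var → Term S
  oddP vx     = var vx
  oddP (vp n) = var (vp (sucℕ (2 * n)))

  comp : Term S → Term S → Term S
  comp s t = subst σ s
    where
    σ : Var → Term S
    σ vx     = subst oddP t
    σ (vp n) = var (vp (2 * n))

  basicTx : (ω : Op S) → Fin (arity S ω) → Term S
  basicTx ω i = op ω (λ j → pick j)
    where
    pick : Fin (arity S ω) → Term S
    pick j with j ≟ i
    ... | yes _ = var vx
    ... | no  _ = var (vp (toℕ j))

TermSet : Signature → Set₁
TermSet S = Term S → Set

_⊆ₜ_ : {S : Signature} → TermSet S → TermSet S → Set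
F ⊆ₜ G = ∀ t → F t → G t

_∘ₜ_ : {S : Signature} → TermSet S → TermSet S → TermSet S
(F ∘ₜ G) u = Σ _ λ s → Σ _ λ t → F s × G t × (u ≡ comp s t)

record IsTx (S : Signature) (T : TermSet S) : Set where
  field
    x∈T    : T (var vx)
    basic∈T : (ω : Op S) → (i : Fin (arity S ω)) → T (basicTx ω i)
    comp∈T : ∀ s t → T s → T t → T (comp s t)

-- Algebras (setoid-based: _≈_ is the equality of the algebra)

record Algebra (S : Signature) (ℓ : Level) : Set (suc ℓ) where
  field
    Carrier : Set ℓ
    _≈_     : Rel Carrier ℓ
    isEquivalence : IsEquivalence _≈_
    ⟦_⟧ₒ    : (ω : Op S) → (Fin (arity S ω) → Carrier) → Carrier
    ⟦⟧ₒ-cong : ∀ ω {as bs} → (∀ i → as i ≈ bs i) → ⟦ ω ⟧ₒ as ≈ ⟦ ω ⟧ₒ bs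

open Algebra public

module _ {S : Signature} {ℓ : Level} (A : Algebra S ℓ) where

  private
    C = Carrier A
    _≈A_ = _≈_ A

  eval : Term S → C → (ℕ → C) → C
  eval (var vx)     a e = a
  eval (var (vp n)) a e = e n
  eval (op ω ts)    a e = ⟦_⟧ₒ A ω (λ i → eval (ts i) a e)

  -- an equivalence relation on the carrier (of A/≈)
  record IsEquivOn (θ : Rel C ℓ) : Set ℓ where
    field
      isEquiv : IsEquivalence θ
      ≈⊆θ     : ∀ {a b} → a ≈A b → θ a b

  record IsCongruence (θ : Rel C ℓ) : Set ℓ where
    field
      isEquivOn : IsEquivOn θ
      compat    : ∀ ω {as bs} → (∀ i → θ (as i) (bs i)) → θ (⟦_⟧ₒ A ω as) (⟦_⟧ₒ A ω bs)

  Cg : C → C → Rel C (suc ℓ)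
  Cg c d u v = (R : Rel C ℓ) → IsCongruence R → R c d → R u v

  -- congruence formulas: a step is a term t_i together with the choice
  -- (z_i', z_i) = (x, y) (false) or (y, x) (true)
  record Step : Set where
    constructor step
    field
      term : Term S
      swap : Bool

  module _ (a b : C) (e : ℕ → C) where
    start : Step → C
    start (step t false) = eval t a e
    start (step t true)  = eval t b e
    end : Step → C
    end (step t false) = eval t b e
    end (step t true)  = eval t a e

    Chain : C → List Step → C → Set ℓ
    Chain u []       v = u ≈A v
    Chain u (s ∷ ss) v = (u ≈A start s) × Chain (end s) ss v

  -- θ^F(a,b): pairs (c,d) with A ⊨ π(c,d,a,b) for some congruence formula
  -- π with term(π) ⊆ F  (π has at least one term t₀)
  θ^ : TermSet S → C → C → Rel C ℓ
  θ^ F a b c d =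
    Σ Step λ s → Σ (List Step) λ ss →
      F (Step.term s) × All (λ r → F (Step.term r)) ss ×
      Σ (ℕ → C) λ e → Chain a b e c (s ∷ ss) d

  θsub : Rel C ℓ → TermSet S → Rel C ℓ
  θsub θ F a b = ∀ t → F t → (e : ℕ → C) → θ (eval t a e) (eval t b e)

_≐_ : ∀ {a ℓ₁ ℓ₂} {C : Set a} → Rel C ℓ₁ → Rel C ℓ₂ → Set (a ⊔ ℓ₁ ⊔ ℓ₂)
R ≐ Q = (∀ {u v} → R u v → Q u v) × (∀ {u v} → Q u v → R u v)

Class : (S : Signature) (ℓ ℓ' : Level) → Set (suc ℓ ⊔ suc ℓ')
Class S ℓ ℓ' = Algebra S ℓ → Set ℓ'

module _ {S : Signature} {ℓ : Level} where

  record IsSurjHom (A B : Algebra S ℓ) (h : Carrier A → Carrier B) : Set ℓ where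
    field
      h-cong : ∀ {a a'} → _≈_ A a a' → _≈_ B (h a) (h a')
      h-op   : ∀ ω (as : Fin (arity S ω) → Carrier A) →
               _≈_ B (h (⟦_⟧ₒ A ω as)) (⟦_⟧ₒ B ω (λ i → h (as i)))
      h-surj : ∀ b → Σ (Carrier A) λ a → _≈_ B (h a) b

  ClosedUnderHomImages : ∀ {ℓ'} → Class S ℓ ℓ' → Set (suc ℓ ⊔ ℓ')
  ClosedUnderHomImages 𝒞 =
    (A B : Algebra S ℓ) → 𝒞 A → (h : Carrier A → Carrier B) → IsSurjHom A B h → 𝒞 B

  DeterminesPrincipalSubcongruences : ∀ {ℓ'} → Class S ℓ ℓ' → TermSet S → TermSet S → Set (suc ℓ ⊔ ℓ')
  DeterminesPrincipalSubcongruences 𝒞 F G =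
    (A : Algebra S ℓ) → 𝒞 A → (a b : Carrier A) → ¬ (_≈_ A a b) →
    Σ (Carrier A) λ c → Σ (Carrier A) λ d →
      ¬ (_≈_ A c d) × θ^ A F a b c d × (Cg A c d ≐ θ^ A G c d)

  syn : (T : TermSet S) (A : Algebra S ℓ) → Rel (Carrier A) ℓ → Rel (Carrier A) ℓ
  syn T A θ = θsub A θ T

  DeterminesSyntacticCongruences : ∀ {ℓ'} → TermSet S → Class S ℓ ℓ' → TermSet S → Set (suc ℓ ⊔ ℓ')
  DeterminesSyntacticCongruences T 𝒞 H =
    (A : Algebra S ℓ) → 𝒞 A → (θ : Rel (Carrier A) ℓ) → IsEquivOn A θ →
    syn T A θ ≐ θsub A θ H

-- Let ψ = syn θ, the largest congruence of A inside θ; the quotient B = A/ψ lies in 𝒞.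
-- If a, b were (G ∘ F)-syntactically θ-related but not ψ-related, the principal
-- subcongruence property of B would give c, d distinct in B with (c, d) ∈ θ^F(a, b) and
-- Cg(c, d) = θ^G(c, d). Pushing the congruence formula witnessing (c, d) ∈ θ^F(a, b)
-- through each g ∈ G shows that c, d are G-syntactically θ-related. Then every formula for
-- θ^G(c, d) stays inside θ, hence so does Cg(c, d) ∋ (t(c, ē), t(d, ē)) for all t ∈ T:
-- that is, c ψ d, a contradiction.
module Submission where

open import Defs
open import Level using (Level)
open import Axiom.ExcludedMiddle using (ExcludedMiddle)
open import Data.Nat using (ℕ; zero; suc; _*_; _<?_)
open import Data.Nat.Properties using (*-suc)
open import Data.Fin using (Fin; zero; suc; toℕ; fromℕ<; _≟_)
open import Data.Fin.Properties using (toℕ<n; fromℕ<-toℕ)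
import Data.Vec.Functional as Vector
open import Data.Bool using (true; false)
open import Data.List using ([]; _∷_)
open import Data.List.Relation.Unary.All using (All; []; _∷_)
open import Data.Product using (_,_)
open import Function using (id; _∘_)
open import Relation.Nullary using (¬_; yes; no; contradiction)
open import Relation.Nullary.Decidable using (decidable-stable)
open import Relation.Binary using (Rel; IsEquivalence; Symmetric; Transitive; _⇒_)
open import Relation.Binary.PropositionalEquality as ≡ using (_≡_; _≢_; refl; cong)

interleave : ∀ {a} {C : Set a} → (ℕ → C) → (ℕ → C) → ℕ → C
interleave f g zero    = f zero
interleave f g (suc n) = interleave g (f ∘ suc) n

interleave-even : ∀ {a} {C : Set a} (f g : ℕ → C) n → interleave f g (2 * n) ≡ f n
interleave-even f g zero    = refl
interleave-even f g (suc n) =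
  ≡.subst (λ k → interleave f g k ≡ f (suc n)) (≡.sym (*-suc 2 n))
    (interleave-even (f ∘ suc) (g ∘ suc) n)

interleave-odd : ∀ {a} {C : Set a} (f g : ℕ → C) n → interleave f g (suc (2 * n)) ≡ g n
interleave-odd f g = interleave-even g (f ∘ suc)

fromTuple : ∀ {a} {C : Set a} {n} → (Fin n → C) → C → ℕ → C
fromTuple {n = n} as default m with m <? n
... | yes m<n = as (fromℕ< m<n)
... | no _    = default

fromTuple-toℕ : ∀ {a} {C : Set a} {n} (as : Fin n → C) default j →
                fromTuple as default (toℕ j) ≡ as j
fromTuple-toℕ {n = n} as default j with toℕ j <? n
... | yes j<n = cong as (fromℕ<-toℕ j j<n)
... | no j≮n  = contradiction (toℕ<n j) j≮n

module _ {a b r s} {C : Set a} {Y : Set b} (_∼_ : Rel C r) (R : Rel Y s) (R-trans : Transitive R) where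

  componentwise : ∀ {n} (h : (Fin n → C) → Y) →
    (∀ {as bs} → (∀ j → as j ≡ bs j) → R (h as) (h bs)) →
    (∀ {as bs} i → as i ∼ bs i → (∀ j → j ≢ i → as j ≡ bs j) → R (h as) (h bs)) →
    ∀ {as bs} → (∀ i → as i ∼ bs i) → R (h as) (h bs)
  componentwise {zero}  h ext replace-one as∼bs = ext (λ ())
  componentwise {suc n} h ext replace-one {as} {bs} as∼bs =
    R-trans (replace-one zero (as∼bs zero) replace-head)
      (R-trans (componentwise (λ cs → h (bs zero Vector.∷ cs)) ext-tail replace-tail (as∼bs ∘ suc))
        (ext λ { zero → refl ; (suc j) → refl }))
    where
    replace-head : ∀ j → j ≢ zero → as j ≡ (bs zero Vector.∷ (as ∘ suc)) j
    replace-head zero    j≢0 = contradiction refl j≢0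
    replace-head (suc j) _   = refl

    ext-tail : ∀ {cs ds} → (∀ j → cs j ≡ ds j) →
               R (h (bs zero Vector.∷ cs)) (h (bs zero Vector.∷ ds))
    ext-tail cs≡ds = ext λ { zero → refl ; (suc j) → cs≡ds j }

    replace-tail : ∀ {cs ds} i → cs i ∼ ds i → (∀ j → j ≢ i → cs j ≡ ds j) →
                   R (h (bs zero Vector.∷ cs)) (h (bs zero Vector.∷ ds))
    replace-tail i cs∼ds off-i =
      replace-one (suc i) cs∼ds λ { zero _ → refl ; (suc j) j≢i → off-i j (j≢i ∘ cong suc) }

arityOf : {S : Signature} → Term S → ℕ
arityOf (var _)  = 0
arityOf {S} (op ω _) = arity S ω

argument : {S : Signature} (t : Term S) → Fin (arityOf t) → Term S
argument (op ω ts) = ts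

module _ {S : Signature} {ℓ : Level} (A : Algebra S ℓ) where

  private
    C : Set ℓ
    C = Carrier A

    _≈A_ : Rel C ℓ
    _≈A_ = _≈_ A

    module ≈A = IsEquivalence (isEquivalence A)

  eval-cong : ∀ t {a a' e e'} → a ≈A a' → (∀ n → e n ≈A e' n) → eval A t a e ≈A eval A t a' e'
  eval-cong (var vx)     a≈a' e≈e' = a≈a'
  eval-cong (var (vp n)) a≈a' e≈e' = e≈e' n
  eval-cong (op ω ts)    a≈a' e≈e' = ⟦⟧ₒ-cong A ω λ i → eval-cong (ts i) a≈a' e≈e'

  eval-subst : ∀ σ t a e →
    eval A (subst σ t) a e ≈A eval A t (eval A (σ vx) a e) (λ n → eval A (σ (vp n)) a e)
  eval-subst σ (var vx)     a e = ≈A.refl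
  eval-subst σ (var (vp n)) a e = ≈A.refl
  eval-subst σ (op ω ts)    a e = ⟦⟧ₒ-cong A ω λ i → eval-subst σ (ts i) a e

  -- comp s t reads the parameters of s at even and those of t at odd positions.
  eval-comp : ∀ s t a e₁ e₂ → eval A (comp s t) a (interleave e₂ e₁) ≈A eval A s (eval A t a e₁) e₂
  eval-comp s t a e₁ e₂ =
    ≈A.trans (eval-subst _ s a e)
      (eval-cong s (≈A.trans (eval-subst oddP t a e)
                             (eval-cong t ≈A.refl λ n → ≈A.reflexive (interleave-odd e₂ e₁ n)))
                   λ n → ≈A.reflexive (interleave-even e₂ e₁ n))
    where e = interleave e₂ e₁

  eval-basicTx : ∀ ω i {as} a e → as i ≈A a → (∀ j → j ≢ i → as j ≈A e (toℕ j)) →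
                 ⟦ A ⟧ₒ ω as ≈A eval A (basicTx ω i) a e
  eval-basicTx ω i {as} a e asᵢ≈a asⱼ≈eⱼ = ⟦⟧ₒ-cong A ω λ j → eval-argument j (asⱼ≈eⱼ j)
    where
    eval-argument : ∀ j → (j ≢ i → as j ≈A e (toℕ j)) → as j ≈A eval A (argument (basicTx ω i) j) a e
    eval-argument j off-i with j ≟ i
    ... | yes refl = asᵢ≈a
    ... | no  j≢i  = off-i j≢i

  congruence-eval : ∀ {R} → IsCongruence A R → ∀ {c d} → R c d → ∀ t e → R (eval A t c e) (eval A t d e)
  congruence-eval R-cong Rcd (var vx)     e = Rcd
  congruence-eval R-cong Rcd (var (vp n)) e =
    IsEquivalence.refl (IsEquivOn.isEquiv (IsCongruence.isEquivOn R-cong))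
  congruence-eval R-cong Rcd (op ω ts)    e =
    IsCongruence.compat R-cong ω λ i → congruence-eval R-cong Rcd (ts i) e

  Cg-eval : ∀ c d t e → Cg A c d (eval A t c e) (eval A t d e)
  Cg-eval c d t e R R-cong Rcd = congruence-eval R-cong Rcd t e

  module _ {r} (ρ : Rel C r) (ρ-sym : Symmetric ρ) (ρ-trans : Transitive ρ) (≈⊆ρ : _≈A_ ⇒ ρ)
           (Q : TermSet S) (c d : C) (Q⊆ρ : ∀ t → Q t → ∀ e → ρ (eval A t c e) (eval A t d e)) where

    private
      step⊆ρ : ∀ e s → Q (Step.term s) → ρ (start A c d e s) (end A c d e s)
      step⊆ρ e (step t false) q = Q⊆ρ t q e
      step⊆ρ e (step t true)  q = ρ-sym (Q⊆ρ t q e)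

      chain⊆ρ : ∀ {e u v} ss → All (λ s → Q (Step.term s)) ss → Chain A c d e u ss v → ρ u v
      chain⊆ρ []       []       u≈v              = ≈⊆ρ u≈v
      chain⊆ρ (s ∷ ss) (q ∷ qs) (u≈start , rest) =
        ρ-trans (≈⊆ρ u≈start) (ρ-trans (step⊆ρ _ s q) (chain⊆ρ ss qs rest))

    θ^-least : θ^ A Q c d ⇒ ρ
    θ^-least (s , ss , q , qs , e , chain) = chain⊆ρ (s ∷ ss) (q ∷ qs) chain

θsub-antitone : ∀ {S ℓ} (A : Algebra S ℓ) {θ H H'} → H ⊆ₜ H' → θsub A θ H' ⇒ θsub A θ H
θsub-antitone A H⊆H' related t Ht = related t (H⊆H' t Ht)

_/_ : ∀ {S ℓ} (A : Algebra S ℓ) {ψ : Rel (Carrier A) ℓ} → IsCongruence A ψ → Algebra S ℓ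
_/_ A {ψ} ψ-cong = record
  { Carrier       = Carrier A
  ; _≈_           = ψ
  ; isEquivalence = IsEquivOn.isEquiv (IsCongruence.isEquivOn ψ-cong)
  ; ⟦_⟧ₒ          = ⟦ A ⟧ₒ
  ; ⟦⟧ₒ-cong      = IsCongruence.compat ψ-cong
  }

module _ {S : Signature} {ℓ : Level} (A : Algebra S ℓ) {ψ : Rel (Carrier A) ℓ} (ψ-cong : IsCongruence A ψ) where

  private
    module ≈A = IsEquivalence (isEquivalence A)

    ≈⊆ψ : _≈_ A ⇒ ψ
    ≈⊆ψ = IsEquivOn.≈⊆θ (IsCongruence.isEquivOn ψ-cong)

  eval-quotient : ∀ t a e → _≈_ A (eval (A / ψ-cong) t a e) (eval A t a e)
  eval-quotient (var vx)     a e = ≈A.refl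
  eval-quotient (var (vp n)) a e = ≈A.refl
  eval-quotient (op ω ts)    a e = ⟦⟧ₒ-cong A ω λ i → eval-quotient (ts i) a e

  quotient-isSurjHom : IsSurjHom A (A / ψ-cong) id
  quotient-isSurjHom = record
    { h-cong = ≈⊆ψ
    ; h-op   = λ ω as → ≈⊆ψ ≈A.refl
    ; h-surj = λ b → b , ≈⊆ψ ≈A.refl
    }

  θ^-quotient-least : ∀ {r} (ρ : Rel (Carrier A) r) → Symmetric ρ → Transitive ρ → ψ ⇒ ρ →
    (Q : TermSet S) (c d : Carrier A) → (∀ t → Q t → ∀ e → ρ (eval A t c e) (eval A t d e)) →
    θ^ (A / ψ-cong) Q c d ⇒ ρ
  θ^-quotient-least ρ ρ-sym ρ-trans ψ⊆ρ Q c d Q⊆ρ =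
    θ^-least (A / ψ-cong) ρ ρ-sym ρ-trans ψ⊆ρ Q c d λ t q e →
      ρ-trans (≈⊆ρ (eval-quotient t c e)) (ρ-trans (Q⊆ρ t q e) (≈⊆ρ (≈A.sym (eval-quotient t d e))))
    where
    ≈⊆ρ : _≈_ A ⇒ ρ
    ≈⊆ρ = ψ⊆ρ ∘ ≈⊆ψ

module _ {S : Signature} {ℓ : Level} (A : Algebra S ℓ) {θ : Rel (Carrier A) ℓ} (θ-equiv : IsEquivOn A θ) where

  private
    module ≈A = IsEquivalence (isEquivalence A)
    open IsEquivOn θ-equiv
    module θ = IsEquivalence isEquiv

  θsub-comp : ∀ {H} s t {a b} → H (comp s t) → θsub A θ H a b →
              ∀ e₁ e₂ → θ (eval A s (eval A t a e₁) e₂) (eval A s (eval A t b e₁) e₂)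
  θsub-comp s t {a} {b} H∋st related e₁ e₂ =
    θ.trans (≈⊆θ (≈A.sym (eval-comp A s t a e₁ e₂)))
      (θ.trans (related (comp s t) H∋st (interleave e₂ e₁)) (≈⊆θ (eval-comp A s t b e₁ e₂)))

  module _ {T : TermSet S} (T-isTx : IsTx S T) where

    private
      open IsTx T-isTx

      ψ : Rel (Carrier A) ℓ
      ψ = syn T A θ

    syn⊆θ : ψ ⇒ θ
    syn⊆θ {a} related = related (var vx) x∈T (λ _ → a)

    syn-isEquivOn : IsEquivOn A ψ
    syn-isEquivOn = record
      { isEquiv = record
        { refl  = λ t Tt e → θ.refl
        ; sym   = λ p t Tt e → θ.sym (p t Tt e)
        ; trans = λ p q t Tt e → θ.trans (p t Tt e) (q t Tt e)
        }
      ; ≈⊆θ = λ a≈b t Tt e → ≈⊆θ (eval-cong A t a≈b λ _ → ≈A.refl)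
      }

    private
      module ψ = IsEquivalence (IsEquivOn.isEquiv syn-isEquivOn)

      ≈⊆syn : _≈_ A ⇒ ψ
      ≈⊆syn = IsEquivOn.≈⊆θ syn-isEquivOn

    syn-translate : ∀ s → T s → ∀ e {u v} → ψ u v → ψ (eval A s u e) (eval A s v e)
    syn-translate s Ts e related t Tt e' = θsub-comp t s (comp∈T t s Tt Ts) related e e'

    -- Changing the i-th argument alone is the basic translation ω(p₀, …, x, …, pₙ₋₁)
    -- with the remaining arguments as parameters.
    syn-replace-one : ∀ ω {as bs} i → ψ (as i) (bs i) → (∀ j → j ≢ i → as j ≡ bs j) →
                      ψ (⟦ A ⟧ₒ ω as) (⟦ A ⟧ₒ ω bs)
    syn-replace-one ω {as} {bs} i asᵢψbsᵢ off-i =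
      ψ.trans (≈⊆syn (eval-basicTx A ω i (as i) e ≈A.refl λ j _ → ≈A.reflexive (e-toℕ j)))
        (ψ.trans (syn-translate (basicTx ω i) (basic∈T ω i) e asᵢψbsᵢ)
          (≈⊆syn (≈A.sym (eval-basicTx A ω i (bs i) e ≈A.refl λ j j≢i →
             ≈A.reflexive (≡.trans (≡.sym (off-i j j≢i)) (e-toℕ j))))))
      where
      e : ℕ → Carrier A
      e = fromTuple as (as i)
      e-toℕ : ∀ j → as j ≡ e (toℕ j)
      e-toℕ j = ≡.sym (fromTuple-toℕ as (as i) j)

    syn-isCongruence : IsCongruence A ψ
    syn-isCongruence = record
      { isEquivOn = syn-isEquivOn
      ; compat    = λ ω → componentwise ψ ψ ψ.trans (⟦ A ⟧ₒ ω)
          (λ as≡bs → ≈⊆syn (⟦⟧ₒ-cong A ω (≈A.reflexive ∘ as≡bs)))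
          (syn-replace-one ω)
      }

    syn-quotient : Algebra S ℓ
    syn-quotient = A / syn-isCongruence

    θ^-quotient⊆syn : ∀ {F G a b} → G ⊆ₜ T → θsub A θ (G ∘ₜ F) a b →
                      θ^ syn-quotient F a b ⇒ θsub A θ G
    θ^-quotient⊆syn {F} {a = a} {b} G⊆T related cd∈θ^F g Gg e₀ =
      θ^-quotient-least A syn-isCongruence (λ x y → θ (eval A g x e₀) (eval A g y e₀))
        θ.sym θ.trans (λ p → p g (G⊆T g Gg) e₀) F a b
        (λ f Ff e → θsub-comp g f (g , f , Gg , Ff , refl) related e e₀)
        cd∈θ^F

    θ^-quotient⊆θ : ∀ {G c d} → θsub A θ G c d → θ^ syn-quotient G c d ⇒ θ
    θ^-quotient⊆θ {G} {c} {d} = θ^-quotient-least A syn-isCongruence θ θ.sym θ.trans syn⊆θ G c d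

    Cg-quotient⊆θ⇒syn : ∀ {c d} → Cg syn-quotient c d ⇒ θ → ψ c d
    Cg-quotient⊆θ⇒syn {c} {d} Cg⊆θ t Tt e =
      θ.trans (≈⊆θ (≈A.sym (eval-quotient A syn-isCongruence t c e)))
        (θ.trans (Cg⊆θ (Cg-eval syn-quotient c d t e))
          (≈⊆θ (eval-quotient A syn-isCongruence t d e)))

proposition3p2 : {ℓ ℓ' : Level} → ExcludedMiddle ℓ →
    (S : Signature) (T : TermSet S) → IsTx S T →
    (𝒞 : Class S ℓ ℓ') → ClosedUnderHomImages 𝒞 →
    (F G : TermSet S) → F ⊆ₜ T → G ⊆ₜ T →
    DeterminesPrincipalSubcongruences 𝒞 F G →
    DeterminesSyntacticCongruences T 𝒞 (G ∘ₜ F)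
proposition3p2 {ℓ} em S T T-isTx 𝒞 𝒞-closed F G F⊆T G⊆T F,G-determine A A∈𝒞 θ θ-equiv =
  θsub-antitone A {θ} G∘F⊆T , λ related → decidable-stable em (not-not-syn related)
  where
  open IsTx T-isTx

  G∘F⊆T : (G ∘ₜ F) ⊆ₜ T
  G∘F⊆T _ (g , f , Gg , Ff , refl) = comp∈T g f (G⊆T g Gg) (F⊆T f Ff)

  B : Algebra S ℓ
  B = syn-quotient A θ-equiv T-isTx

  B∈𝒞 : 𝒞 B
  B∈𝒞 = 𝒞-closed A B A∈𝒞 id (quotient-isSurjHom A (syn-isCongruence A θ-equiv T-isTx))

  not-not-syn : ∀ {a b} → θsub A θ (G ∘ₜ F) a b → ¬ ¬ syn T A θ a b
  not-not-syn related a≉b with F,G-determine B B∈𝒞 _ _ a≉b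
  ... | c , d , c≉d , cd∈θ^F , Cg⊆θ^G , _ =
    c≉d (Cg-quotient⊆θ⇒syn A θ-equiv T-isTx λ cd∈Cg →
      θ^-quotient⊆θ A θ-equiv T-isTx (θ^-quotient⊆syn A θ-equiv T-isTx G⊆T related cd∈θ^F)
        (Cg⊆θ^G cd∈Cg))
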